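{- Let $\mathcal{R}$ be a symmetric association scheme. If all pairs of non-trivial relations fuse, then $\mathcal{R}$ is amorphic.
   Context: A symmetric $d$-class association scheme on a finite set $X$ is a set $\mathcal{R}=\{A_0,\dots,A_d\}$ of $X\times X$ $01$-matrices with $A_0=I$, $\sum_iA_i=J$, $A_i^\top=A_i$, $A_iA_j=\sum_h p_{ij}^hA_h$; $A_1,\dots,A_d$ are the non-trivial relations. A pair $\{A_i,A_j\}$ ($i\neq j$, $i,j\ge 1$) fuses if replacing $A_i,A_j$ by $A_i+A_j$ (keeping the others) yields an association scheme. $\mathcal{R}$ is amorphic if for every partition of $\{0,\dots,d\}$ having $\{0\}$ as a part, the sums of the $A_l$ over the parts form an association scheme. -}

module Defs where

open import Data.Nat using (ℕ; zero; suc; _+_; _*_)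
open import Data.Fin using (Fin; zero; suc; _≟_)
open import Data.Bool using (if_then_else_)
open import Data.Product using (Σ; ∃; _×_; _,_)
open import Data.Sum using (_⊎_)
open import Relation.Nullary using (¬_)
open import Relation.Nullary.Decidable using (⌊_⌋)
open import Relation.Binary.PropositionalEquality using (_≡_)

Σ[_] : ∀ k → (Fin k → ℕ) → ℕ
Σ[ zero ] f = 0
Σ[ suc k ] f = f zero + Σ[ k ] (λ i → f (suc i))

Matrix : ℕ → Set
Matrix n = Fin n → Fin n → ℕ

I : ∀ {n} → Matrix n
I x y = if ⌊ x ≟ y ⌋ then 1 else 0

_·_ : ∀ {n} → Matrix n → Matrix n → Matrix n
_·_ {n} A B x y = Σ[ n ] (λ z → A x z * B z y)

-- A family A₀,…,A_d (indexed by Fin (suc d)) of X × X matrices is a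
-- symmetric d-class association scheme on X = Fin n.
record IsSymScheme {n d : ℕ} (A : Fin (suc d) → Matrix n) : Set where
  field
    zeroOne   : ∀ i x y → A i x y ≡ 0 ⊎ A i x y ≡ 1
    identity  : ∀ x y → A zero x y ≡ I x y
    sumJ      : ∀ x y → Σ[ suc d ] (λ i → A i x y) ≡ 1
    symmetric : ∀ i x y → A i x y ≡ A i y x
    closed    : Σ (Fin (suc d) → Fin (suc d) → Fin (suc d) → ℕ) λ p →
                  ∀ i j x y → (A i · A j) x y ≡ Σ[ suc d ] (λ h → p i j h * A h x y)

-- A partition of {0,…,d} having {0} as a part, given by the map sending
-- each index to the (label of the) part containing it; parts are the
-- (nonempty) fibres of f.
record IsPartitionWith0 {d e : ℕ} (f : Fin (suc d) → Fin (suc e)) : Set where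
  field
    surjective : ∀ k → ∃ λ a → f a ≡ k
    zeroPart   : ∀ a → f a ≡ zero → a ≡ zero
    zeroZero   : f zero ≡ zero

fuse : ∀ {n d e} → (Fin (suc d) → Matrix n) → (Fin (suc d) → Fin (suc e)) →
       Fin (suc e) → Matrix n
fuse {d = d} A f k x y = Σ[ suc d ] (λ a → if ⌊ f a ≟ k ⌋ then A a x y else 0)

-- The pair {A_i, A_j} fuses: replacing A_i, A_j by A_i + A_j (keeping the
-- others) yields an association scheme.  The partition whose only
-- non-singleton part is {i, j}.
Fuses : ∀ {n d} → (Fin (suc d) → Matrix n) → Fin (suc d) → Fin (suc d) → Set
Fuses {n} {d} A i j =
  Σ ℕ λ e → Σ (Fin (suc d) → Fin (suc e)) λ f →
    IsPartitionWith0 f ×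
    (∀ a b → f a ≡ f b → a ≡ b ⊎ (a ≡ i × b ≡ j) ⊎ (a ≡ j × b ≡ i)) ×
    f i ≡ f j ×
    IsSymScheme (fuse A f)

Amorphic : ∀ {n d} → (Fin (suc d) → Matrix n) → Set
Amorphic {n} {d} A =
  ∀ (e : ℕ) (f : Fin (suc d) → Fin (suc e)) → IsPartitionWith0 f →
    IsSymScheme (fuse A f)

-- Each pair (x , y) lies in exactly one relation of the scheme A, its class κ x y.  A fusion
-- B of A is again a scheme as soon as every entry (B k · B l) x y depends only on the
-- B-class of (x , y); the structure constants are then read off any representative.  For
-- two pairs in the same A-class this holds because A is a scheme.  If their A-classes
-- c ≠ c' are merged by the fusion, both are non-trivial, so by hypothesis merging just c and
-- c' gives a scheme C.  The fusion factors through C, hence B k · B l is a product of fused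
-- relations of C, and in C the two pairs lie in the same class.

module Submission where

open import Defs
open import Data.Nat using (ℕ; zero; suc; _+_; _*_)
open import Data.Nat.Properties
  using (+-identityʳ; *-identityˡ; *-identityʳ; *-zeroʳ; *-distribˡ-+; *-distribʳ-+;
         +-commutativeSemigroup; m+n≡0⇒m≡0; m+n≡0⇒n≡0)
  renaming (suc-injective to ℕ-suc-injective)
open import Data.Nat.Solver using (module +-*-Solver)
open import Algebra.Properties.CommutativeSemigroup +-commutativeSemigroup using (interchange)
open import Data.Fin using (Fin; zero; suc; _≟_)
open import Data.Fin.Properties using (suc-injective; any?)
open import Data.Bool using (if_then_else_)
open import Data.Product using (∃; ∃₂; _×_; _,_; proj₁; proj₂)
open import Data.Sum using (_⊎_; inj₁; inj₂)
open import Function using (_∘_)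
open import Relation.Nullary using (¬_; Dec; yes; no; contradiction)
open import Relation.Nullary.Decidable using (⌊_⌋)
open import Relation.Binary.PropositionalEquality
open ≡-Reasoning

private
  variable
    n r k d e e' : ℕ

Σ-cong : ∀ k {f g : Fin k → ℕ} → (∀ i → f i ≡ g i) → Σ[ k ] f ≡ Σ[ k ] g
Σ-cong zero    f≗g = refl
Σ-cong (suc k) f≗g = cong₂ _+_ (f≗g zero) (Σ-cong k (f≗g ∘ suc))

Σ-zero : ∀ k → Σ[ k ] (λ _ → 0) ≡ 0
Σ-zero zero    = refl
Σ-zero (suc k) = Σ-zero k

Σ≡0⇒≡0 : ∀ k (f : Fin k → ℕ) → Σ[ k ] f ≡ 0 → ∀ i → f i ≡ 0
Σ≡0⇒≡0 (suc k) f Σf≡0 zero    = m+n≡0⇒m≡0 (f zero) Σf≡0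
Σ≡0⇒≡0 (suc k) f Σf≡0 (suc i) = Σ≡0⇒≡0 k (f ∘ suc) (m+n≡0⇒n≡0 (f zero) Σf≡0) i

Σ-distrib-+ : ∀ k (f g : Fin k → ℕ) → Σ[ k ] (λ i → f i + g i) ≡ Σ[ k ] f + Σ[ k ] g
Σ-distrib-+ zero    f g = refl
Σ-distrib-+ (suc k) f g =
  trans (cong (f zero + g zero +_) (Σ-distrib-+ k (f ∘ suc) (g ∘ suc)))
        (interchange (f zero) (g zero) (Σ[ k ] (f ∘ suc)) (Σ[ k ] (g ∘ suc)))

*-distribˡ-Σ : ∀ k c (f : Fin k → ℕ) → c * Σ[ k ] f ≡ Σ[ k ] (λ i → c * f i)
*-distribˡ-Σ zero    c f = *-zeroʳ c
*-distribˡ-Σ (suc k) c f =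
  trans (*-distribˡ-+ c (f zero) _) (cong (c * f zero +_) (*-distribˡ-Σ k c (f ∘ suc)))

*-distribʳ-Σ : ∀ k c (f : Fin k → ℕ) → Σ[ k ] f * c ≡ Σ[ k ] (λ i → f i * c)
*-distribʳ-Σ zero    c f = refl
*-distribʳ-Σ (suc k) c f =
  trans (*-distribʳ-+ c (f zero) _) (cong (f zero * c +_) (*-distribʳ-Σ k c (f ∘ suc)))

Σ-*-Σ : ∀ k m (f : Fin k → ℕ) (g : Fin m → ℕ) →
  Σ[ k ] f * Σ[ m ] g ≡ Σ[ k ] (λ i → Σ[ m ] (λ j → f i * g j))
Σ-*-Σ k m f g = trans (*-distribʳ-Σ k _ f) (Σ-cong k (λ i → *-distribˡ-Σ m (f i) g))

Σ-comm : ∀ k m (f : Fin k → Fin m → ℕ) →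
  Σ[ k ] (λ i → Σ[ m ] (f i)) ≡ Σ[ m ] (λ j → Σ[ k ] (λ i → f i j))
Σ-comm zero    m f = sym (Σ-zero m)
Σ-comm (suc k) m f =
  trans (cong (Σ[ m ] (f zero) +_) (Σ-comm k m (f ∘ suc)))
        (sym (Σ-distrib-+ m (f zero) (λ j → Σ[ k ] (λ i → f (suc i) j))))

Σ-pick : ∀ k {f : Fin k → ℕ} c → (∀ i → ¬ i ≡ c → f i ≡ 0) → Σ[ k ] f ≡ f c
Σ-pick (suc k) {f} zero f≡0 =
  trans (cong (f zero +_) (trans (Σ-cong k (λ i → f≡0 (suc i) λ ())) (Σ-zero k)))
        (+-identityʳ (f zero))
Σ-pick (suc k) {f} (suc c) f≡0 =
  cong₂ _+_ (f≡0 zero λ ()) (Σ-pick k c (λ i i≢c → f≡0 (suc i) (i≢c ∘ suc-injective)))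

δ : Fin k → Fin k → ℕ
δ = I

δ-refl : (a : Fin k) → δ a a ≡ 1
δ-refl a with a ≟ a
... | yes _   = refl
... | no a≢a = contradiction refl a≢a

δ-≢ : {a b : Fin k} → ¬ a ≡ b → δ a b ≡ 0
δ-≢ {a = a} {b} a≢b with a ≟ b
... | yes a≡b = contradiction a≡b a≢b
... | no _    = refl

δ-cong : {a b : Fin k} {a' b' : Fin r} →
  (a ≡ b → a' ≡ b') → (a' ≡ b' → a ≡ b) → δ a b ≡ δ a' b'
δ-cong {a = a} {b} {a'} {b'} to from with a ≟ b | a' ≟ b'
... | yes _   | yes _    = refl
... | no _    | no _     = refl
... | yes a≡b | no a'≢b' = contradiction (to a≡b) a'≢b'
... | no a≢b  | yes a'≡b' = contradiction (from a'≡b') a≢b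

δ-suc : (a b : Fin k) → δ (suc a) (suc b) ≡ δ a b
δ-suc a b = δ-cong suc-injective (cong suc)

δ-0∨1 : (a b : Fin k) → δ a b ≡ 0 ⊎ δ a b ≡ 1
δ-0∨1 a b with a ≟ b
... | yes _ = inj₂ refl
... | no _  = inj₁ refl

if-≟-as-δ : (a b : Fin k) (v : ℕ) → (if ⌊ a ≟ b ⌋ then v else 0) ≡ δ a b * v
if-≟-as-δ a b v with a ≟ b
... | yes _ = sym (+-identityʳ v)
... | no _  = refl

Σ-δ : ∀ k (w : Fin k → ℕ) c → Σ[ k ] (λ a → w a * δ c a) ≡ w c
Σ-δ k w c =
  trans (Σ-pick k c (λ a a≢c → trans (cong (w a *_) (δ-≢ (a≢c ∘ sym))) (*-zeroʳ (w a))))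
        (trans (cong (w c *_) (δ-refl c)) (*-identityʳ (w c)))

Σ≡1⇒δ : ∀ k (f : Fin k → ℕ) → Σ[ k ] f ≡ 1 → ∃ λ c → ∀ i → f i ≡ δ c i
Σ≡1⇒δ (suc k) f Σf≡1 with f zero in f₀
... | 0 with Σ≡1⇒δ k (f ∘ suc) Σf≡1
...   | c , f≗δ = suc c , λ { zero → f₀ ; (suc i) → trans (f≗δ i) (sym (δ-suc c i)) }
Σ≡1⇒δ (suc k) f Σf≡1 | 1 =
  zero , λ { zero → f₀ ; (suc i) → Σ≡0⇒≡0 k (f ∘ suc) (ℕ-suc-injective Σf≡1) i }

StructureConstants : (Fin r → Matrix n) → (Fin r → Fin r → Fin r → ℕ) → Set
StructureConstants {r = r} E p =
  ∀ i j x y → (E i · E j) x y ≡ Σ[ r ] (λ h → p i j h * E h x y)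

Classifies : (Fin n → Fin n → Fin r) → (Fin r → Matrix n) → Set
Classifies κ E = ∀ i x y → E i x y ≡ δ (κ x y) i

classifier : (E : Fin r → Matrix n) → (∀ x y → Σ[ r ] (λ i → E i x y) ≡ 1) →
  ∃ λ κ → Classifies κ E
classifier {r} E Σ≡1 =
  (λ x y → proj₁ (Σ≡1⇒δ r _ (Σ≡1 x y))) , (λ i x y → proj₂ (Σ≡1⇒δ r _ (Σ≡1 x y)) i)

module _ {κ : Fin n → Fin n → Fin r} {E : Fin r → Matrix n} (κ-classifies : Classifies κ E) where

  classified-0∨1 : ∀ i x y → E i x y ≡ 0 ⊎ E i x y ≡ 1
  classified-0∨1 i x y rewrite κ-classifies i x y = δ-0∨1 (κ x y) i

  classified-Σ≡1 : ∀ x y → Σ[ r ] (λ i → E i x y) ≡ 1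
  classified-Σ≡1 x y =
    trans (Σ-cong r (λ i → trans (κ-classifies i x y) (sym (*-identityˡ _))))
          (Σ-δ r (λ _ → 1) (κ x y))

  product-by-class : ∀ {p} → StructureConstants E p →
    ∀ i j x y → (E i · E j) x y ≡ p i j (κ x y)
  product-by-class {p} p-const i j x y =
    trans (p-const i j x y)
          (trans (Σ-cong r (λ h → cong (p i j h *_) (κ-classifies h x y))) (Σ-δ r (p i j) (κ x y)))

factorise : (κ : Fin n → Fin n → Fin r) (T : Matrix n) →
  (∀ {x y x' y'} → κ x y ≡ κ x' y' → T x y ≡ T x' y') →
  ∃ λ (t : Fin r → ℕ) → ∀ x y → T x y ≡ t (κ x y)
factorise κ T T-invariant = (λ m → valueOn (fibre? m)) , T≡valueOn
  where
  fibre? : ∀ m → Dec (∃₂ λ x y → κ x y ≡ m)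
  fibre? m = any? (λ x → any? (λ y → κ x y ≟ m))

  valueOn : ∀ {m} → Dec (∃₂ λ x y → κ x y ≡ m) → ℕ
  valueOn (yes (x , y , _)) = T x y
  valueOn (no _)            = 0

  T≡valueOn : ∀ x y → T x y ≡ valueOn (fibre? (κ x y))
  T≡valueOn x y with fibre? (κ x y)
  ... | yes (x' , y' , κ'≡κ) = T-invariant (sym κ'≡κ)
  ... | no  empty            = contradiction (x , y , refl) empty

structureConstants-from-invariance : {κ : Fin n → Fin n → Fin r} {B : Fin r → Matrix n} →
  Classifies κ B →
  (∀ k l {x y x' y'} → κ x y ≡ κ x' y' → (B k · B l) x y ≡ (B k · B l) x' y') →
  ∃ (StructureConstants B)
structureConstants-from-invariance {r = r} {κ = κ} {B} κ-classifies invariant =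
  p , λ k l x y → begin
    (B k · B l) x y
      ≡⟨ proj₂ (product-factorises k l) x y ⟩
    p k l (κ x y)
      ≡⟨ Σ-δ r (p k l) (κ x y) ⟨
    Σ[ r ] (λ h → p k l h * δ (κ x y) h)
      ≡⟨ Σ-cong r (λ h → cong (p k l h *_) (κ-classifies h x y)) ⟨
    Σ[ r ] (λ h → p k l h * B h x y) ∎
  where
  product-factorises : ∀ k l → ∃ λ t → ∀ x y → (B k · B l) x y ≡ t (κ x y)
  product-factorises k l = factorise κ (B k · B l) (invariant k l)

  p : Fin r → Fin r → Fin r → ℕ
  p k l = proj₁ (product-factorises k l)

·-cong : {P P' Q Q' : Matrix n} → (∀ x y → P x y ≡ P' x y) → (∀ x y → Q x y ≡ Q' x y) →
  ∀ x y → (P · Q) x y ≡ (P' · Q') x y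
·-cong {n} P≗P' Q≗Q' x y = Σ-cong n (λ z → cong₂ _*_ (P≗P' x z) (Q≗Q' z y))

combination : (Fin r → ℕ) → (Fin r → Matrix n) → Matrix n
combination {r} u E x y = Σ[ r ] (λ a → u a * E a x y)

·-bilinear : (u v : Fin r → ℕ) (P Q : Fin r → Matrix n) → ∀ x y →
  (combination u P · combination v Q) x y
    ≡ Σ[ r ] (λ a → u a * Σ[ r ] (λ b → v b * (P a · Q b) x y))
·-bilinear {r} {n} u v P Q x y = begin
  Σ[ n ] (λ z → Σ[ r ] (λ a → u a * P a x z) * Σ[ r ] (λ b → v b * Q b z y))
    ≡⟨ Σ-cong n (λ z → Σ-*-Σ r r _ _) ⟩
  Σ[ n ] (λ z → Σ[ r ] (λ a → Σ[ r ] (λ b → term a b z)))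
    ≡⟨ Σ-comm n r _ ⟩
  Σ[ r ] (λ a → Σ[ n ] (λ z → Σ[ r ] (λ b → term a b z)))
    ≡⟨ Σ-cong r (λ a → Σ-comm n r (λ z b → term a b z)) ⟩
  Σ[ r ] (λ a → Σ[ r ] (λ b → Σ[ n ] (λ z → term a b z)))
    ≡⟨ Σ-cong r (λ a → Σ-cong r (λ b → pull-out a b)) ⟩
  Σ[ r ] (λ a → Σ[ r ] (λ b → u a * (v b * (P a · Q b) x y)))
    ≡⟨ Σ-cong r (λ a → *-distribˡ-Σ r (u a) _) ⟨
  Σ[ r ] (λ a → u a * Σ[ r ] (λ b → v b * (P a · Q b) x y)) ∎
  where
  open +-*-Solver using (solve; _:*_; _:=_)

  term : Fin r → Fin r → Fin n → ℕ
  term a b z = (u a * P a x z) * (v b * Q b z y)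

  pull-out : ∀ a b → Σ[ n ] (term a b) ≡ u a * (v b * (P a · Q b) x y)
  pull-out a b = begin
    Σ[ n ] (term a b)
      ≡⟨ Σ-cong n (λ z → solve 4 (λ p q s t → (p :* q) :* (s :* t) := p :* (s :* (q :* t))) refl
                                 (u a) (P a x z) (v b) (Q b z y)) ⟩
    Σ[ n ] (λ z → u a * (v b * (P a x z * Q b z y)))
      ≡⟨ *-distribˡ-Σ n (u a) _ ⟨
    u a * Σ[ n ] (λ z → v b * (P a x z * Q b z y))
      ≡⟨ cong (u a *_) (*-distribˡ-Σ n (v b) _) ⟨
    u a * (v b * (P a · Q b) x y) ∎

fuse-as-combination : (E : Fin (suc d) → Matrix n) (f : Fin (suc d) → Fin (suc e)) →
  ∀ k x y → fuse E f k x y ≡ combination (λ a → δ (f a) k) E x y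
fuse-as-combination {d = d} E f k x y = Σ-cong (suc d) (λ a → if-≟-as-δ (f a) k (E a x y))

fuse-classifies : {E : Fin (suc d) → Matrix n} {κ : Fin n → Fin n → Fin (suc d)} →
  Classifies κ E → (f : Fin (suc d) → Fin (suc e)) → Classifies (λ x y → f (κ x y)) (fuse E f)
fuse-classifies {d = d} {E = E} {κ} κ-classifies f k x y = begin
  fuse E f k x y
    ≡⟨ fuse-as-combination E f k x y ⟩
  Σ[ suc d ] (λ a → δ (f a) k * E a x y)
    ≡⟨ Σ-cong (suc d) (λ a → cong (δ (f a) k *_) (κ-classifies a x y)) ⟩
  Σ[ suc d ] (λ a → δ (f a) k * δ (κ x y) a)
    ≡⟨ Σ-δ (suc d) (λ a → δ (f a) k) (κ x y) ⟩
  δ (f (κ x y)) k ∎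

fuse-fuse : {E : Fin (suc d) → Matrix n} {κ : Fin n → Fin n → Fin (suc d)} → Classifies κ E →
  {f : Fin (suc d) → Fin (suc e)} {g : Fin (suc d) → Fin (suc e')} {f' : Fin (suc e') → Fin (suc e)} →
  (∀ a → f a ≡ f' (g a)) → ∀ k x y → fuse E f k x y ≡ fuse (fuse E g) f' k x y
fuse-fuse {E = E} {κ} κ-classifies {f} {g} {f'} f≗f'∘g k x y = begin
  fuse E f k x y              ≡⟨ fuse-classifies κ-classifies f k x y ⟩
  δ (f (κ x y)) k             ≡⟨ cong (λ c → δ c k) (f≗f'∘g (κ x y)) ⟩
  δ (f' (g (κ x y))) k        ≡⟨ fuse-classifies (fuse-classifies κ-classifies g) f' k x y ⟨
  fuse (fuse E g) f' k x y    ∎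

fusedConstant : (Fin (suc d) → Fin (suc d) → Fin (suc d) → ℕ) → (Fin (suc d) → Fin (suc e)) →
  Fin (suc e) → Fin (suc e) → Fin (suc d) → ℕ
fusedConstant {d = d} p f k l c =
  Σ[ suc d ] (λ a → δ (f a) k * Σ[ suc d ] (λ b → δ (f b) l * p a b c))

fuse-product-by-class : {E : Fin (suc d) → Matrix n} {κ : Fin n → Fin n → Fin (suc d)} →
  Classifies κ E → ∀ {p} → StructureConstants E p → (f : Fin (suc d) → Fin (suc e)) →
  ∀ k l x y → (fuse E f k · fuse E f l) x y ≡ fusedConstant p f k l (κ x y)
fuse-product-by-class {d = d} {E = E} {κ} κ-classifies {p} p-const f k l x y = begin
  (fuse E f k · fuse E f l) x y
    ≡⟨ ·-cong (fuse-as-combination E f k) (fuse-as-combination E f l) x y ⟩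
  (combination (λ a → δ (f a) k) E · combination (λ b → δ (f b) l) E) x y
    ≡⟨ ·-bilinear (λ a → δ (f a) k) (λ b → δ (f b) l) E E x y ⟩
  Σ[ suc d ] (λ a → δ (f a) k * Σ[ suc d ] (λ b → δ (f b) l * (E a · E b) x y))
    ≡⟨ Σ-cong (suc d) (λ a → cong (δ (f a) k *_) (Σ-cong (suc d) (λ b →
         cong (δ (f b) l *_) (product-by-class κ-classifies {p} p-const a b x y)))) ⟩
  fusedConstant p f k l (κ x y) ∎

fuse-products-class-invariant : {E : Fin (suc d) → Matrix n} {κ : Fin n → Fin n → Fin (suc d)} →
  Classifies κ E → ∀ {p} → StructureConstants E p → (f : Fin (suc d) → Fin (suc e)) →
  ∀ k l {x y x' y'} → κ x y ≡ κ x' y' →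
  (fuse E f k · fuse E f l) x y ≡ (fuse E f k · fuse E f l) x' y'
fuse-products-class-invariant κ-classifies {p} p-const f k l {x} {y} {x'} {y'} same-class =
  trans (fuse-product-by-class κ-classifies {p} p-const f k l x y)
        (trans (cong (fusedConstant p f k l) same-class)
               (sym (fuse-product-by-class κ-classifies {p} p-const f k l x' y')))

factorsThrough : ∀ {a b c} {A : Set a} {B : Set b} {C : Set c} (f : A → C) (g : A → B) →
  (∀ y → ∃ λ x → g x ≡ y) → (∀ x x' → g x ≡ g x' → f x ≡ f x') →
  ∃ λ (f' : B → C) → ∀ x → f x ≡ f' (g x)
factorsThrough f g g-surjective g-finer =
  (λ y → f (proj₁ (g-surjective y))) , λ x → g-finer x _ (sym (proj₂ (g-surjective (g x))))

merging-only-pair-refines : ∀ {a b c} {A : Set a} {B : Set b} {C : Set c}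
  {f : A → C} {g : A → B} {i j : A} →
  (∀ x x' → g x ≡ g x' → x ≡ x' ⊎ (x ≡ i × x' ≡ j) ⊎ (x ≡ j × x' ≡ i)) →
  f i ≡ f j → ∀ x x' → g x ≡ g x' → f x ≡ f x'
merging-only-pair-refines g-merges-only fi≡fj x x' gx≡gx' with g-merges-only x x' gx≡gx'
... | inj₁ refl                  = refl
... | inj₂ (inj₁ (refl , refl)) = fi≡fj
... | inj₂ (inj₂ (refl , refl)) = sym fi≡fj

merged-with-other⇒≢0 : {f : Fin (suc d) → Fin (suc e)} → IsPartitionWith0 f →
  ∀ {c c'} → f c ≡ f c' → ¬ c ≡ c' → ¬ c ≡ zero
merged-with-other⇒≢0 P {c' = c'} fc≡fc' c≢c' refl =
  c≢c' (sym (zeroPart c' (trans (sym fc≡fc') zeroZero)))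
  where open IsPartitionWith0 P

module _ {d} {A : Fin (suc d) → Matrix n} (S : IsSymScheme A) where
  open IsSymScheme S

  private
    κ : Fin n → Fin n → Fin (suc d)
    κ = proj₁ (classifier A sumJ)

    κ-classifies : Classifies κ A
    κ-classifies = proj₂ (classifier A sumJ)

  fuse-identity : {f : Fin (suc d) → Fin (suc e)} → IsPartitionWith0 f →
    ∀ x y → fuse A f zero x y ≡ I x y
  fuse-identity {f = f} P x y = begin
    fuse A f zero x y    ≡⟨ fuse-classifies κ-classifies f zero x y ⟩
    δ (f (κ x y)) zero   ≡⟨ δ-cong (zeroPart (κ x y)) (λ κ≡0 → trans (cong f κ≡0) zeroZero) ⟩
    δ (κ x y) zero       ≡⟨ κ-classifies zero x y ⟨
    A zero x y           ≡⟨ identity x y ⟩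
    I x y                ∎
    where open IsPartitionWith0 P

  fuse-symmetric : (f : Fin (suc d) → Fin (suc e)) → ∀ k x y → fuse A f k x y ≡ fuse A f k y x
  fuse-symmetric f k x y =
    Σ-cong (suc d) (λ a → cong (λ v → if ⌊ f a ≟ k ⌋ then v else 0) (symmetric a x y))

  fuse-products-agree-across-merged-pair : (f : Fin (suc d) → Fin (suc e)) →
    ∀ {x y x' y'} → Fuses A (κ x y) (κ x' y') → f (κ x y) ≡ f (κ x' y') →
    ∀ k l → (fuse A f k · fuse A f l) x y ≡ (fuse A f k · fuse A f l) x' y'
  fuse-products-agree-across-merged-pair {e = e} f {x} {y} {x'} {y'}
    (e' , g , g-partition , g-merges-only , g-merges , g-scheme) f-merges k l = begin
      (fuse A f k · fuse A f l) x y      ≡⟨ regroup x y ⟩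
      (C f' k · C f' l) x y              ≡⟨ fuse-products-class-invariant
                                              (fuse-classifies κ-classifies g) {proj₁ closedC}
                                              (proj₂ closedC) f' k l g-merges ⟩
      (C f' k · C f' l) x' y'            ≡⟨ regroup x' y' ⟨
      (fuse A f k · fuse A f l) x' y'    ∎
    where
    C : (Fin (suc e') → Fin (suc e)) → Fin (suc e) → Matrix n
    C = fuse (fuse A g)

    closedC : ∃ (StructureConstants (fuse A g))
    closedC = IsSymScheme.closed g-scheme

    f-through-g : ∃ λ (f' : Fin (suc e') → Fin (suc e)) → ∀ a → f a ≡ f' (g a)
    f-through-g = factorsThrough f g (IsPartitionWith0.surjective g-partition)
                    (merging-only-pair-refines g-merges-only f-merges)

    f' : Fin (suc e') → Fin (suc e)
    f' = proj₁ f-through-g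

    regroup : ∀ x y → (fuse A f k · fuse A f l) x y ≡ (C f' k · C f' l) x y
    regroup = ·-cong (fuse-fuse κ-classifies {f = f} {g} {f'} (proj₂ f-through-g) k)
                     (fuse-fuse κ-classifies {f = f} {g} {f'} (proj₂ f-through-g) l)

  fuse-products-agree : (∀ i j → ¬ i ≡ j → ¬ i ≡ zero → ¬ j ≡ zero → Fuses A i j) →
    {f : Fin (suc d) → Fin (suc e)} → IsPartitionWith0 f →
    ∀ k l {x y x' y'} → f (κ x y) ≡ f (κ x' y') →
    (fuse A f k · fuse A f l) x y ≡ (fuse A f k · fuse A f l) x' y'
  fuse-products-agree all-pairs-fuse {f} P k l {x} {y} {x'} {y'} f-merges
    with κ x y ≟ κ x' y'
  ... | yes same-class =
    fuse-products-class-invariant κ-classifies {proj₁ closed} (proj₂ closed) f k l same-class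
  ... | no other-class =
    fuse-products-agree-across-merged-pair f
      (all-pairs-fuse _ _ other-class (merged-with-other⇒≢0 P f-merges other-class)
                                      (merged-with-other⇒≢0 P (sym f-merges) (other-class ∘ sym)))
      f-merges k l

  fuse-isSymScheme : (∀ i j → ¬ i ≡ j → ¬ i ≡ zero → ¬ j ≡ zero → Fuses A i j) →
    {f : Fin (suc d) → Fin (suc e)} → IsPartitionWith0 f → IsSymScheme (fuse A f)
  fuse-isSymScheme all-pairs-fuse {f} P = record
    { zeroOne   = classified-0∨1 fused-classifies
    ; identity  = fuse-identity P
    ; sumJ      = classified-Σ≡1 fused-classifies
    ; symmetric = fuse-symmetric f
    ; closed    = structureConstants-from-invariance fused-classifies
                    (fuse-products-agree all-pairs-fuse P)
    }
    where
    fused-classifies : Classifies (λ x y → f (κ x y)) (fuse A f)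
    fused-classifies = fuse-classifies κ-classifies f

theorem3p2 : ∀ {n d : ℕ} (A : Fin (suc d) → Matrix n) → IsSymScheme A →
    (∀ (i j : Fin (suc d)) → ¬ i ≡ j → ¬ i ≡ zero → ¬ j ≡ zero → Fuses A i j) →
    Amorphic A
theorem3p2 A S all-pairs-fuse e f P = fuse-isSymScheme S all-pairs-fuse P
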